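{- Let $k\geq 3$ be odd and let $a_1,\dots,a_{k-1}$ be distinct positive integers, none divisible by $k$, such that $G=\mathrm{Cay}(\mathbb{Z}, \pm\{a_1,\dots,a_{k-1},k\})$ is admissible. If there exists a Hamilton path $Q$ in the complete graph with vertex set $\mathbb{Z}_k$ such that the multiset $\{\ell(x,y) : \{x,y\}\in E(Q)\}$ equals the multiset $\{\ell([0],[a_i]) : i=1,\dots,k-1\}$, then $G$ is Hamilton-decomposable.
   Context: For an inverse-closed set $S$ of distinct non-zero integers, $\mathrm{Cay}(\mathbb{Z},S)$ is the simple graph with vertex set $\mathbb{Z}$ and edge set $\{\{g,g+s\} : g\in\mathbb{Z}, s\in S\}$, and $S^+=\{a\in S: a>0\}$; $\pm A$ denotes $A\cup(-A)$. $[x]$ denotes the congruence class of $x$ modulo $k$. For $u,v\in\mathbb{Z}_k$, the length $\ell(u,v)$ is the distance between $u$ and $v$ in the cycle $\mathrm{Cay}(\mathbb{Z}_k,\{\pm1\})$, i.e. $\min(r,k-r)$ where $r\in\{0,\dots,k-1\}$, $r\equiv u-v \pmod k$. A Hamilton path in the finite complete graph is a path visiting every vertex exactly once. A (two-way-infinite) Hamilton path of an infinite graph is a connected spanning $2$-valent subgraph; a Hamilton decomposition is a set of pairwise edge-disjoint Hamilton paths whose union contains all edges. $\mathrm{Cay}(\mathbb{Z},S)$ is admissible if (i) $S=\emptyset$ or $\gcd(S)=1$, and (ii) if $S$ is finite then $\sum_{a\in S^+} a\equiv |S^+| \pmod 2$. -}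

module Defs where

open import Data.Nat as ℕ using (ℕ; zero; suc; _∸_; _%_; _⊓_)
open import Data.Nat.GCD using (gcd)
open import Data.Integer as ℤ using (ℤ; +_; -_)
open import Data.Fin using (Fin; toℕ; inject₁) renaming (suc to fsuc)
open import Data.List using (List; []; _∷_; map; foldr; length; allFin)
open import Data.Nat.ListAction using (sum)
open import Data.List.Relation.Unary.Any using (Any)
open import Data.Product using (Σ; ∃; ∃₂; _×_)
open import Data.Sum using (_⊎_)
open import Relation.Binary.PropositionalEquality using (_≡_; _≢_)
open import Relation.Binary.Construct.Closure.ReflexiveTransitive using (Star)

-- The inverse-closed connection set ±A, for A a list of positive integers
-- (A plays the role of S⁺).
PM : List ℕ → ℤ → Set
PM A d = Any (λ a → d ≡ + a ⊎ d ≡ - (+ a)) A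

IsSubgraph : (S : ℤ → Set) → (ℤ → ℤ → Set) → Set
IsSubgraph S H = (∀ x y → H x y → S (y ℤ.- x)) × (∀ x y → H x y → H y x)

TwoValent : (ℤ → ℤ → Set) → Set
TwoValent H = ∀ x → ∃₂ λ y z → y ≢ z × H x y × H x z × (∀ w → H x w → w ≡ y ⊎ w ≡ z)

Connected : (ℤ → ℤ → Set) → Set
Connected H = ∀ x y → Star H x y

HamPath : (S : ℤ → Set) → (ℤ → ℤ → Set) → Set
HamPath S H = IsSubgraph S H × TwoValent H × Connected H

HamDecomposable : (S : ℤ → Set) → Set₁
HamDecomposable S =
  Σ Set λ I → Σ (I → ℤ → ℤ → Set) λ H →
    (∀ i → HamPath S (H i)) ×
    (∀ i j x y → H i x y → H j x y → i ≡ j) ×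
    (∀ x y → S (y ℤ.- x) → ∃ λ i → H i x y)

gcdList : List ℕ → ℕ
gcdList = foldr gcd 0

Admissible : List ℕ → Set
Admissible A = (A ≡ [] ⊎ gcdList A ≡ 1) × (sum A % 2 ≡ length A % 2)

-- ℓ(u,v) = min(r, k - r) with r ≡ u - v (mod k), 0 ≤ r < k
len : (k : ℕ) → ℕ → ℕ → ℕ
len zero    u v = 0
len (suc n) u v = r ⊓ (suc n ∸ r)
  where r = (u ℕ.+ (suc n ∸ v % suc n)) % suc n

pathLengths : (k : ℕ) → (Fin k → Fin k) → List ℕ
pathLengths zero    Q = []
pathLengths (suc n) Q =
  map (λ i → len (suc n) (toℕ (Q (inject₁ i))) (toℕ (Q (fsuc i)))) (allFin n)

-- Write K = k and m = K - 1. Since the edge lengths of Q are the lengths ℓ(0, a_i), there is a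
-- permutation ρ with Q(t+1) - Q(t) ≡ ±a_ρ(t) (mod K); lifting Q step by step gives integers
-- X(0), …, X(m) with X(t+1) - X(t) = ±a_ρ(t), forming a complete residue system mod K. The
-- translates X + sK, run through forwards for even s and backwards for odd s, concatenate to a
-- bijection Y : ℤ → ℤ whose steps are ±a_i inside a block and K at each turn, so the K translates
-- Y + 2i (0 ≤ i < K) are Hamilton paths of G. The step of generator d taken in block s of Y + 2i
-- is the edge {b + sK + 2i, b + sK + 2i + d}, where the base point b depends only on d and the
-- parity of s: it alternates between X(m) and X(0) for d = K, and X(m) - X(0) ≡ Σ a_i is even by
-- admissibility. As K is odd, (s, i) ↦ b + sK + 2i is then a bijection ℤ × [0, K) → ℤ, so every
-- edge of G lies in exactly one of the K paths.

module Submission where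

open import Defs
open import Data.Nat as ℕ using (ℕ; zero; suc; NonZero; _≤_; _<_; _∸_; _%_; _/_)
import Data.Nat.Properties as ℕP
import Data.Nat.DivMod as ℕD
import Data.Nat.ListAction as List
open import Data.Nat.Divisibility using (_∣_; ∣-refl)
open import Data.Integer as ℤ using (ℤ; +_; -[1+_]; -_; _+_; _*_; _-_; ∣_∣)
import Data.Integer.Properties as ℤP
open import Data.Integer.DivMod using (_/ℕ_; n%ℕd<d; a≡a%ℕn+[a/ℕn]*n)
open import Data.Integer.Tactic.RingSolver using (solve-∀)
open import Algebra.Properties.AbelianGroup ℤP.+-0-abelianGroup using (∙-cancelˡ; ∙-cancelʳ)
open import Algebra.Properties.CommutativeMonoid.Sum ℕP.+-0-commutativeMonoid using (sum; sum-permute)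
open import Data.Fin as Fin using (Fin; toℕ; fromℕ; fromℕ<; inject₁; opposite; cast; punchOut)
import Data.Fin.Properties as FinP
open import Data.Fin.Induction using (<-weakInduction)
open import Data.Fin.Permutation using (Permutation; _⟨$⟩ʳ_; _⟨$⟩ˡ_; _∘ₚ_; cast-id; inverseˡ; inverseʳ)
open import Data.Fin.Relation.Unary.Top using (view; ‵fromℕ; ‵inject₁)
open import Data.List using (_∷_; map; allFin; tabulate; lookup; length)
import Data.List.Properties as ListP
open import Data.List.Relation.Unary.Any using (here; there)
import Data.List.Relation.Unary.Any.Properties as AnyP
open import Data.List.Relation.Binary.Permutation.Propositional using (_↭_; ↭⇒↭ₛ)
open import Data.List.Relation.Binary.Permutation.Homogeneous using (onIndices)
import Data.List.Relation.Binary.Permutation.Setoid.Properties as PermutationSetoidP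
open import Data.Product using (Σ; ∃; ∃₂; _×_; _,_; proj₁; proj₂)
open import Data.Sum using (_⊎_; inj₁; inj₂; [_,_])
open import Data.Empty using (⊥-elim)
open import Function using (id; const; _∘_)
open import Function.Definitions using (Injective)
open import Relation.Binary.PropositionalEquality
  using (_≡_; _≢_; refl; sym; trans; cong; cong₂; subst; subst₂; setoid; module ≡-Reasoning)
open import Relation.Binary.Construct.Closure.ReflexiveTransitive using (Star; ε; _◅_; _◅◅_; reverse)
open import Relation.Nullary using (¬_; yes; no)

-- Congruences of integers

infix 4 _≡_mod_ _≡±_

record _≡_mod_ (x y : ℤ) (n : ℕ) : Set where
  constructor congruent
  field
    quotient : ℤ
    equality : x ≡ y + quotient * + n

_≡±_ : ℤ → ℕ → Set
d ≡± a = d ≡ + a ⊎ d ≡ - + a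

module _ {n : ℕ} where

  ≡⇒≡mod : ∀ {x y} → x ≡ y → x ≡ y mod n
  ≡⇒≡mod {y = y} refl = congruent (+ 0) (sym (lemma y (+ n)))
    where lemma : ∀ y n → y + + 0 * n ≡ y
          lemma = solve-∀

  mod-sym : ∀ {x y} → x ≡ y mod n → y ≡ x mod n
  mod-sym {x} {y} (congruent c refl) = congruent (- c) (sym (lemma y c (+ n)))
    where lemma : ∀ y c n → y + c * n + - c * n ≡ y
          lemma = solve-∀

  mod-trans : ∀ {x y z} → x ≡ y mod n → y ≡ z mod n → x ≡ z mod n
  mod-trans {z = z} (congruent c refl) (congruent d refl) = congruent (d + c) (lemma z c d (+ n))
    where lemma : ∀ z c d n → z + d * n + c * n ≡ z + (d + c) * n
          lemma = solve-∀

  mod-+ : ∀ {x y u v} → x ≡ y mod n → u ≡ v mod n → x + u ≡ y + v mod n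
  mod-+ {y = y} {v = v} (congruent c refl) (congruent d refl) = congruent (c + d) (lemma y v c d (+ n))
    where lemma : ∀ y v c d n → y + c * n + (v + d * n) ≡ y + v + (c + d) * n
          lemma = solve-∀

  mod-neg : ∀ {x y} → x ≡ y mod n → - x ≡ - y mod n
  mod-neg {y = y} (congruent c refl) = congruent (- c) (lemma y c (+ n))
    where lemma : ∀ y c n → - (y + c * n) ≡ - y + - c * n
          lemma = solve-∀

  mod-*ˡ : ∀ z {x y} → x ≡ y mod n → z * x ≡ z * y mod n
  mod-*ˡ z {y = y} (congruent c refl) = congruent (z * c) (lemma z y c (+ n))
    where lemma : ∀ z y c n → z * (y + c * n) ≡ z * y + z * c * n
          lemma = solve-∀

  mod-cancelʳ : ∀ {x y} z → x + z ≡ y + z mod n → x ≡ y mod n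
  mod-cancelʳ {x} {y} z eq =
    mod-trans (≡⇒≡mod (lemma x z)) (mod-trans (mod-+ eq (≡⇒≡mod refl)) (≡⇒≡mod (sym (lemma y z))))
    where lemma : ∀ x z → x ≡ x + z + - z
          lemma = solve-∀

  +-multiple : ∀ x c → x + c * + n ≡ x mod n
  +-multiple x c = congruent c refl

mod-shift : ∀ {n x y c} → x - y ≡ c mod n → x ≡ y + c mod n
mod-shift {n} {x} {y} {c} (congruent q eq) =
  congruent q (trans (lemma₁ x y) (trans (cong (_+_ y) eq) (lemma₂ y c q (+ n))))
  where lemma₁ : ∀ x y → x ≡ y + (x - y)
        lemma₁ = solve-∀
        lemma₂ : ∀ y c q n → y + (c + q * n) ≡ y + c + q * n
        lemma₂ = solve-∀

mod-unique : ∀ {n j j'} → j ℕ.< n → j' ℕ.< n → + j ≡ + j' mod n → j ≡ j'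
mod-unique {n} {j} {j'} j<n j'<n (congruent c eq) =
  ℤP.+-injective (trans eq (trans (cong (λ c → + j' + c * + n) c≡0) (lemma (+ j') (+ n))))
  where
    lemma : ∀ j n → j + + 0 * n ≡ j
    lemma = solve-∀
    diff≡ : c * + n ≡ + j - + j'
    diff≡ = trans (lemma′ (+ j') (c * + n)) (cong (_- + j') (sym eq))
      where lemma′ : ∀ j x → x ≡ j + x - j
            lemma′ = solve-∀
    ∣c∣n<1n : ∣ c ∣ ℕ.* n ℕ.< 1 ℕ.* n
    ∣c∣n<1n = begin-strict
      ∣ c ∣ ℕ.* n       ≡⟨ ℤP.∣i*j∣≡∣i∣*∣j∣ c (+ n) ⟨
      ∣ c * + n ∣        ≡⟨ cong ∣_∣ (trans diff≡ (ℤP.m-n≡m⊖n j j')) ⟩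
      ∣ j ℤ.⊖ j' ∣       ≤⟨ ℤP.∣m⊝n∣≤m⊔n j j' ⟩
      j ℕ.⊔ j'           <⟨ ℕP.⊔-lub j<n j'<n ⟩
      n                  ≡⟨ ℕP.*-identityˡ n ⟨
      1 ℕ.* n            ∎
      where open ℕP.≤-Reasoning
    c≡0 : c ≡ + 0
    c≡0 = ℤP.∣i∣≡0⇒i≡0 (ℕP.n<1⇒n≡0 (ℕP.*-cancelʳ-< n ∣ c ∣ 1 ∣c∣n<1n))

module _ (n : ℕ) .{{_ : ℕ.NonZero n}} where

  %-mod : ∀ a → + (a % n) ≡ + a mod n
  %-mod a = mod-sym (congruent (+ (a / n)) (begin
    + a                              ≡⟨ cong +_ (ℕD.m≡m%n+[m/n]*n a n) ⟩
    + (a % n ℕ.+ a / n ℕ.* n)       ≡⟨ ℤP.pos-+ (a % n) (a / n ℕ.* n) ⟩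
    + (a % n) + + (a / n ℕ.* n)     ≡⟨ cong (λ x → + (a % n) + x) (ℤP.pos-* (a / n) n) ⟩
    + (a % n) + + (a / n) * + n     ∎))
    where open ≡-Reasoning

  -- Abstract: Y is defined by cases on a residue, and letting unification unfold the division
  -- algorithm makes type checking intractable.
  abstract
    residue : ∀ z → ∃ λ (j : Fin n) → z ≡ + toℕ j mod n
    residue z = fromℕ< (n%ℕd<d z n) , congruent (z /ℕ n)
      (trans (a≡a%ℕn+[a/ℕn]*n z n) (cong (λ j → + j + (z /ℕ n) * + n) (sym (FinP.toℕ-fromℕ< _))))

  residue-unique : ∀ {j j' : Fin n} {s s'} → + toℕ j + s * + n ≡ + toℕ j' + s' * + n → j ≡ j' × s ≡ s'
  residue-unique {j} {j'} {s} {s'} eq = j≡j' , s≡s'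
    where
      j≡j' : j ≡ j'
      j≡j' = FinP.toℕ-injective (mod-unique (FinP.toℕ<n j) (FinP.toℕ<n j')
        (mod-trans (mod-sym (+-multiple (+ toℕ j) s)) (mod-trans (≡⇒≡mod eq) (+-multiple (+ toℕ j') s'))))
      s≡s' : s ≡ s'
      s≡s' = ℤP.*-cancelʳ-≡ s s' (+ n)
        (∙-cancelˡ (+ toℕ j) _ _ (trans eq (cong (λ j → + toℕ j + s' * + n) (sym j≡j'))))

∸-mod : ∀ {n y} → y ℕ.≤ n → + (n ∸ y) ≡ - + y mod n
∸-mod {n} {y} y≤n = congruent (+ 1) (begin
  + (n ∸ y)        ≡⟨ ℤP.⊖-≥ y≤n ⟨
  n ℤ.⊖ y          ≡⟨ ℤP.m-n≡m⊖n n y ⟨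
  + n - + y        ≡⟨ lemma (+ n) (+ y) ⟩
  - + y + + 1 * + n ∎)
  where
    open ≡-Reasoning
    lemma : ∀ n y → n - y ≡ - y + + 1 * n
    lemma = solve-∀

parity : ∀ z → z ≡ + 0 mod 2 ⊎ z ≡ + 1 mod 2
parity z with residue 2 z
... | Fin.zero , z≡0 = inj₁ z≡0
... | Fin.suc Fin.zero , z≡1 = inj₂ z≡1

0≢1-mod2 : ¬ (+ 0 ≡ + 1 mod 2)
0≢1-mod2 0≡1 with mod-unique {2} {0} {1} (ℕ.s≤s ℕ.z≤n) (ℕ.s≤s (ℕ.s≤s ℕ.z≤n)) 0≡1
... | ()

mod2-dichotomy : ∀ x y → x ≡ y mod 2 ⊎ x ≡ y + + 1 mod 2
mod2-dichotomy x y with parity (x - y)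
... | inj₁ x-y≡0 = inj₁ (subst (λ v → x ≡ v mod 2) (ℤP.+-identityʳ y) (mod-shift x-y≡0))
... | inj₂ x-y≡1 = inj₂ (mod-shift x-y≡1)

≡±-neg : ∀ {d a} → d ≡± a → - d ≡± a
≡±-neg (inj₁ refl) = inj₂ refl
≡±-neg {a = a} (inj₂ refl) = inj₁ (ℤP.neg-involutive (+ a))

-- Lengths in ℤ_k

infix 4 _≡±_mod_

_≡±_mod_ : ℤ → ℕ → ℕ → Set
x ≡± a mod n = x ≡ + a mod n ⊎ x ≡ - + a mod n

module _ {n : ℕ} where

  ≡±mod-neg : ∀ {x a} → x ≡± a mod n → - x ≡± a mod n
  ≡±mod-neg (inj₁ x≡a) = inj₂ (mod-neg x≡a)
  ≡±mod-neg {a = a} (inj₂ x≡-a) = inj₁ (subst (λ y → _ ≡ y mod n) (ℤP.neg-involutive (+ a)) (mod-neg x≡-a))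

  ≡±mod-trans : ∀ {x a b} → x ≡± a mod n → + b ≡± a mod n → x ≡± b mod n
  ≡±mod-trans (inj₁ x≡a) (inj₁ b≡a) = inj₁ (mod-trans x≡a (mod-sym b≡a))
  ≡±mod-trans (inj₂ x≡-a) (inj₂ b≡-a) = inj₁ (mod-trans x≡-a (mod-sym b≡-a))
  ≡±mod-trans {a = a} (inj₁ x≡a) (inj₂ b≡-a) =
    inj₂ (mod-trans x≡a (mod-sym (subst (λ y → _ ≡ y mod n) (ℤP.neg-involutive (+ a)) (mod-neg b≡-a))))
  ≡±mod-trans (inj₂ x≡-a) (inj₁ b≡a) = inj₂ (mod-trans x≡-a (mod-neg (mod-sym b≡a)))

module _ (n : ℕ) where
  private
    K = suc n
    rem : ℕ → ℕ → ℕ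
    rem u v = (u ℕ.+ (K ∸ v % K)) % K

  rem-mod : ∀ u v → + rem u v ≡ + u - + v mod K
  rem-mod u v = mod-trans (%-mod K (u ℕ.+ (K ∸ v % K)))
    (subst (λ x → x ≡ + u - + v mod K) (sym (ℤP.pos-+ u (K ∸ v % K)))
      (mod-+ (≡⇒≡mod {x = + u} refl) (mod-trans (∸-mod (ℕP.<⇒≤ (ℕD.m%n<n v K))) (mod-neg (%-mod K v)))))

  len-residue : ∀ u v → + u - + v ≡± len K u v mod K
  len-residue u v with ℕP.⊓-sel (rem u v) (K ∸ rem u v)
  ... | inj₁ ℓ≡r = inj₁ (mod-trans (mod-sym (rem-mod u v)) (≡⇒≡mod (cong +_ (sym ℓ≡r))))
  ... | inj₂ ℓ≡K∸r = inj₂ (mod-trans (mod-sym (rem-mod u v)) (mod-sym -ℓ≡r))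
    where
      -ℓ≡r : - + len K u v ≡ + rem u v mod K
      -ℓ≡r = subst (λ x → - + len K u v ≡ x mod K) (ℤP.neg-involutive (+ rem u v))
        (mod-neg (subst (λ ℓ → + ℓ ≡ - + rem u v mod K) (sym ℓ≡K∸r)
          (∸-mod (ℕP.<⇒≤ (ℕD.m%n<n (u ℕ.+ (K ∸ v % K)) K)))))

  len-≡⇒≡±mod : ∀ u v b → len K u v ≡ len K 0 b → + v - + u ≡± b mod K
  len-≡⇒≡±mod u v b ℓ≡ =
    ≡±mod-trans (subst (_≡± len K u v mod K) (lemma (+ u) (+ v)) (≡±mod-neg (len-residue u v)))
    (subst₂ (λ x ℓ → x ≡± ℓ mod K) (lemma′ (+ b)) (sym ℓ≡) (≡±mod-neg (len-residue 0 b)))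
    where lemma : ∀ u v → - (u - v) ≡ v - u
          lemma = solve-∀
          lemma′ : ∀ b → - (+ 0 - b) ≡ b
          lemma′ = solve-∀

≡±mod⇒signed : ∀ {x a n} → x ≡± a mod n → ∃ λ e → (e ≡± a) × (x ≡ e mod n)
≡±mod⇒signed {a = a} (inj₁ x≡a) = + a , inj₁ refl , x≡a
≡±mod⇒signed {a = a} (inj₂ x≡-a) = - + a , inj₂ refl , x≡-a

-- Tiling ℤ with an odd modulus

module Tiling (K : ℕ) .{{_ : NonZero K}} (K-odd : + K ≡ + 1 mod 2) (B : ℤ → ℤ)
  (B-periodic : ∀ {s s'} → s ≡ s' mod 2 → B s ≡ B s')
  (B-parity : ∀ s s' → B s ≡ B s' mod 2) where

  tile : ℤ → Fin K → ℤ
  tile s i = B s + s * + K + + toℕ i * + 2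

  tile-mod2 : ∀ s i → tile s i ≡ s + B s mod 2
  tile-mod2 s i = mod-trans (+-multiple (B s + s * + K) (+ toℕ i))
    (subst (λ x → B s + s * + K ≡ x mod 2) (ℤP.+-comm (B s) s)
      (mod-+ (≡⇒≡mod {x = B s} refl) (subst (λ x → s * + K ≡ x mod 2) (ℤP.*-identityʳ s) (mod-*ˡ s K-odd))))

  tile-≡⇒parity : ∀ {s s' i i'} → tile s i ≡ tile s' i' → s ≡ s' mod 2
  tile-≡⇒parity {s} {s'} {i} {i'} eq = mod-cancelʳ (B s) (mod-trans (mod-sym (tile-mod2 s i))
    (mod-trans (≡⇒≡mod eq) (mod-trans (tile-mod2 s' i') (mod-+ (≡⇒≡mod {x = s'} refl) (B-parity s' s)))))

  tile-injective : ∀ {s s' i i'} → tile s i ≡ tile s' i' → i ≡ i'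
  tile-injective {s' = s'} {i = i} {i'} eq = same-parity (tile-≡⇒parity {i = i} {i'} eq) eq
    where
      same-parity : ∀ {s} → s ≡ s' mod 2 → tile s i ≡ tile s' i' → i ≡ i'
      same-parity {s} (congruent u refl) eq = proj₁ (residue-unique K {i} {i'} {u} {+ 0}
        (ℤP.*-cancelʳ-≡ _ _ (+ 2) (halve (B s') s' u (+ K) (+ toℕ i) (+ toℕ i')
          (subst (λ b → b + s * + K + + toℕ i * + 2 ≡ tile s' i') (B-periodic (congruent u refl)) eq))))
        where
          halve : ∀ b s' u k i i' → b + (s' + u * + 2) * k + i * + 2 ≡ b + s' * k + i' * + 2 →
                  (i + u * k) * + 2 ≡ (i' + + 0 * k) * + 2
          halve b s' u k i i' e = trans (l₁ b s' u k i) (trans (cong (λ x → x - b - s' * k) e) (l₂ b s' k i'))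
            where l₁ : ∀ b s' u k i → (i + u * k) * + 2 ≡ b + (s' + u * + 2) * k + i * + 2 - b - s' * k
                  l₁ = solve-∀
                  l₂ : ∀ b s' k i' → b + s' * k + i' * + 2 - b - s' * k ≡ (i' + + 0 * k) * + 2
                  l₂ = solve-∀

  split : ∀ {z b} → z ≡ b mod 2 → ∃₂ λ t i → z ≡ b + t * + 2 * + K + + toℕ i * + 2
  split {b = b} (congruent c refl) with residue K c
  ... | i , congruent t refl = t , i , lemma b (+ toℕ i) t (+ K)
    where lemma : ∀ b i t k → b + (i + t * k) * + 2 ≡ b + t * + 2 * k + i * + 2
          lemma = solve-∀

  tile-surjective : ∀ z → ∃₂ λ s i → z ≡ tile s i
  tile-surjective z with mod2-dichotomy z (B (+ 0))
  ... | inj₁ z≡B₀ with split z≡B₀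
  ...   | t , i , z≡ = t * + 2 , i ,
          trans z≡ (cong (λ b → b + t * + 2 * + K + + toℕ i * + 2) (B-periodic (congruent (- t) (lemma t))))
    where lemma : ∀ t → + 0 ≡ t * + 2 + - t * + 2
          lemma = solve-∀
  tile-surjective z | inj₂ z≡B₀+1 with split (mod-trans z≡B₀+1 (mod-+ (B-parity (+ 0) (+ 1)) (mod-sym K-odd)))
  ...   | t , i , z≡ = t * + 2 + + 1 , i , trans z≡ (trans (lemma₁ (B (+ 1)) t (+ K) (+ toℕ i))
          (cong (λ b → b + (t * + 2 + + 1) * + K + + toℕ i * + 2) (B-periodic (congruent (- t) (lemma₂ t)))))
    where lemma₁ : ∀ b t k i → b + k + t * + 2 * k + i * + 2 ≡ b + (t * + 2 + + 1) * k + i * + 2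
          lemma₁ = solve-∀
          lemma₂ : ∀ t → + 1 ≡ t * + 2 + + 1 + - t * + 2
          lemma₂ = solve-∀

-- Hamilton paths of Cay(ℤ, S) from bijections ℤ → ℤ

⟅_,_⟆≡⟅_,_⟆ : ℤ → ℤ → ℤ → ℤ → Set
⟅ x , y ⟆≡⟅ u , v ⟆ = (x ≡ u × y ≡ v) ⊎ (x ≡ v × y ≡ u)

pair-swap : ∀ {x y u v} → ⟅ x , y ⟆≡⟅ u , v ⟆ → ⟅ y , x ⟆≡⟅ u , v ⟆
pair-swap (inj₁ (x≡u , y≡v)) = inj₂ (y≡v , x≡u)
pair-swap (inj₂ (x≡v , y≡u)) = inj₁ (y≡u , x≡v)

pair-sym : ∀ {x y u v} → ⟅ x , y ⟆≡⟅ u , v ⟆ → ⟅ u , v ⟆≡⟅ x , y ⟆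
pair-sym (inj₁ (refl , refl)) = inj₁ (refl , refl)
pair-sym (inj₂ (refl , refl)) = inj₂ (refl , refl)

pair-trans : ∀ {x y u v p q} → ⟅ x , y ⟆≡⟅ u , v ⟆ → ⟅ u , v ⟆≡⟅ p , q ⟆ → ⟅ x , y ⟆≡⟅ p , q ⟆
pair-trans (inj₁ (refl , refl)) uv = uv
pair-trans (inj₂ (refl , refl)) uv = pair-swap uv

edge-+ : ∀ {x y p a} d → ⟅ x , y ⟆≡⟅ p , p + + a ⟆ → ⟅ x + d , y + d ⟆≡⟅ p + d , p + d + + a ⟆
edge-+ {p = p} {a} d (inj₁ (refl , refl)) = inj₁ (refl , lemma p (+ a) d)
  where lemma : ∀ p a d → p + a + d ≡ p + d + a
        lemma = solve-∀
edge-+ {p = p} {a} d (inj₂ (refl , refl)) = inj₂ (lemma p (+ a) d , refl)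
  where lemma : ∀ p a d → p + a + d ≡ p + d + a
        lemma = solve-∀

≡±⇒pair : ∀ x y {a} → y - x ≡± a → ∃ λ p → ⟅ x , y ⟆≡⟅ p , p + + a ⟆
≡±⇒pair x y (inj₁ y-x≡a) = x , inj₁ (refl , trans (lemma y x) (cong (_+_ x) y-x≡a))
  where lemma : ∀ y x → y ≡ x + (y - x)
        lemma = solve-∀
≡±⇒pair x y {a} (inj₂ y-x≡-a) =
  y , inj₂ (trans (lemma y x) (trans (cong (λ d → y + - d) y-x≡-a) (cong (_+_ y) (ℤP.neg-involutive (+ a)))) , refl)
  where lemma : ∀ y x → x ≡ y + - (y - x)
        lemma = solve-∀

pair⇒≡± : ∀ {x y p a} → ⟅ x , y ⟆≡⟅ p , p + + a ⟆ → y - x ≡± a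
pair⇒≡± {p = p} {a} (inj₁ (refl , refl)) = inj₁ (lemma p (+ a))
  where lemma : ∀ p a → p + a - p ≡ a
        lemma = solve-∀
pair⇒≡± {p = p} {a} (inj₂ (refl , refl)) = inj₂ (lemma p (+ a))
  where lemma : ∀ p a → p - (p + a) ≡ - a
        lemma = solve-∀

p≢p+a+b : ∀ p a a' → 0 ℕ.< a → p ≢ p + + a + + a'
p≢p+a+b p a a' 0<a eq = ℕP.<⇒≢ 0<a (sym (ℕP.m+n≡0⇒m≡0 a
  (ℤP.+-injective (∙-cancelˡ p _ _ (trans e′ (trans (sym eq) (sym (ℤP.+-identityʳ p))))))))
  where e′ : p + + (a ℕ.+ a') ≡ p + + a + + a'
        e′ = trans (cong (_+_ p) (ℤP.pos-+ a a')) (sym (ℤP.+-assoc p (+ a) (+ a')))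

pair-unique : ∀ {x y p p' a a'} → 0 ℕ.< a →
              ⟅ x , y ⟆≡⟅ p , p + + a ⟆ → ⟅ x , y ⟆≡⟅ p' , p' + + a' ⟆ → p ≡ p' × a ≡ a'
pair-unique {x} _ (inj₁ (refl , refl)) (inj₁ (refl , e)) = refl , ℤP.+-injective (∙-cancelˡ x _ _ e)
pair-unique {y = y} _ (inj₂ (refl , refl)) (inj₂ (e , refl)) = refl , ℤP.+-injective (∙-cancelˡ y _ _ e)
pair-unique {p = p} {a = a} {a'} 0<a (inj₁ (refl , refl)) (inj₂ (e , refl)) = ⊥-elim (p≢p+a+b p a a' 0<a e)
pair-unique {p = p} {a = a} {a'} 0<a (inj₂ (refl , refl)) (inj₁ (refl , e)) = ⊥-elim (p≢p+a+b p a a' 0<a e)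

Consecutive : (ℤ → ℤ) → ℤ → ℤ → Set
Consecutive F x y = ∃ λ n → ⟅ x , y ⟆≡⟅ F n , F (n + + 1) ⟆

HamDecomposable-resp : ∀ {S S' : ℤ → Set} → (∀ d → S d → S' d) → (∀ d → S' d → S d) →
                       HamDecomposable S → HamDecomposable S'
HamDecomposable-resp {S} {S'} S⊆S' S'⊆S (I , H , ham , disjoint , cover) =
  I , H , (λ i → subgraph (ham i)) , disjoint , λ x y d∈S' → cover x y (S'⊆S _ d∈S')
  where
    subgraph : ∀ {G} → HamPath S G → HamPath S' G
    subgraph ((edges∈S , symmetric) , two-valent , connected) =
      ((λ x y e → S⊆S' _ (edges∈S x y e)) , symmetric) , two-valent , connected

module _ (S : ℤ → Set) (S-neg : ∀ {d} → S d → S (- d)) (F : ℤ → ℤ)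
         (F-injective : ∀ {m n} → F m ≡ F n → m ≡ n) (F-surjective : ∀ z → ∃ λ n → F n ≡ z)
         (F-step : ∀ n → S (F (n + + 1) - F n)) where

  private
    edge∈S : ∀ x y → Consecutive F x y → S (y - x)
    edge∈S x y (n , inj₁ (refl , refl)) = F-step n
    edge∈S x y (n , inj₂ (refl , refl)) = subst S (lemma (F (n + + 1)) (F n)) (S-neg (F-step n))
      where lemma : ∀ a b → - (a - b) ≡ b - a
            lemma = solve-∀

    consecutive-sym : ∀ x y → Consecutive F x y → Consecutive F y x
    consecutive-sym x y (n , p) = n , pair-swap p

    pred-suc : ∀ n → n - + 1 + + 1 ≡ n
    pred-suc = solve-∀

    two-valent : TwoValent (Consecutive F)
    two-valent x with F-surjective x
    ... | n , refl = F (n + + 1) , F (n - + 1) , next≢prev ,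
                     (n , inj₁ (refl , refl)) , (n - + 1 , inj₂ (cong F (sym (pred-suc n)) , refl)) , only
      where
        next≢prev : F (n + + 1) ≢ F (n - + 1)
        next≢prev eq with trans (lemma₁ n) (trans (cong (λ m → m - n + + 1) (F-injective eq)) (lemma₂ n))
          where lemma₁ : ∀ n → + 2 ≡ n + + 1 - n + + 1
                lemma₁ = solve-∀
                lemma₂ : ∀ n → n - + 1 - n + + 1 ≡ + 0
                lemma₂ = solve-∀
        ... | ()
        only : ∀ w → Consecutive F (F n) w → w ≡ F (n + + 1) ⊎ w ≡ F (n - + 1)
        only w (m , inj₁ (Fn≡Fm , refl)) with refl ← F-injective Fn≡Fm = inj₁ refl
        only w (m , inj₂ (Fn≡Fm+1 , refl)) with refl ← F-injective Fn≡Fm+1 = inj₂ (cong F (sym (lemma m)))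
          where lemma : ∀ m → m + + 1 - + 1 ≡ m
                lemma = solve-∀

    forward : ∀ n d → Star (Consecutive F) (F n) (F (n + + d))
    forward n zero = subst (λ m → Star (Consecutive F) (F n) (F m)) (sym (ℤP.+-identityʳ n)) ε
    forward n (suc d) = forward n d ◅◅ (n + + d , inj₁ (refl , cong F (lemma n (+ d)))) ◅ ε
      where lemma : ∀ n d → n + (+ 1 + d) ≡ n + d + + 1
            lemma = solve-∀

    connected : Connected (Consecutive F)
    connected x y with F-surjective x | F-surjective y
    ... | m , refl | n , refl with n - m in n-m≡
    ... | + d = subst (λ k → Star (Consecutive F) (F m) (F k))
                      (trans (cong (λ k → m + k) (sym n-m≡)) (lemma m n)) (forward m d)
      where lemma : ∀ m n → m + (n - m) ≡ n
            lemma = solve-∀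
    ... | -[1+ d ] = subst (λ k → Star (Consecutive F) (F k) (F n))
                           (trans (cong (λ k → n + - k) (sym n-m≡)) (lemma m n))
                       (reverse (λ {a} {b} → consecutive-sym a b) (forward n (suc d)))
      where lemma : ∀ m n → n + - (n - m) ≡ m
            lemma = solve-∀

  bijection⇒HamPath : HamPath S (Consecutive F)
  bijection⇒HamPath = (edge∈S , consecutive-sym) , two-valent , connected

-- The zigzag decomposition

alternate : ∀ {A : Set} → A → A → ℤ → A
alternate a b s = [ const a , const b ] (parity s)

module _ {A : Set} (a b : A) where

  alternate-even : ∀ {s} → s ≡ + 0 mod 2 → alternate a b s ≡ a
  alternate-even {s} s≡0 with parity s
  ... | inj₁ _ = refl
  ... | inj₂ s≡1 = ⊥-elim (0≢1-mod2 (mod-trans (mod-sym s≡0) s≡1))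

  alternate-odd : ∀ {s} → s ≡ + 1 mod 2 → alternate a b s ≡ b
  alternate-odd {s} s≡1 with parity s
  ... | inj₁ s≡0 = ⊥-elim (0≢1-mod2 (mod-trans (mod-sym s≡0) s≡1))
  ... | inj₂ _ = refl

  alternate-periodic : ∀ {s s'} → s ≡ s' mod 2 → alternate a b s ≡ alternate a b s'
  alternate-periodic {s} s≡s' with parity s
  ... | inj₁ s≡0 = sym (alternate-even (mod-trans (mod-sym s≡s') s≡0))
  ... | inj₂ s≡1 = sym (alternate-odd (mod-trans (mod-sym s≡s') s≡1))

opposite-inject₁ : ∀ {m} (u : Fin m) → opposite (inject₁ u) ≡ Fin.suc (opposite u)
opposite-inject₁ {suc m} Fin.zero = refl
opposite-inject₁ {suc m} (Fin.suc u) = cong inject₁ (opposite-inject₁ u)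

module ZigZag (m : ℕ) (K-odd : + suc m ≡ + 1 mod 2)
  (X : Fin (suc m) → ℤ)
  (X-injective : ∀ {r r'} → X r ≡ X r' mod suc m → r ≡ r')
  (X-surjective : ∀ z → ∃ λ r → z ≡ X r mod suc m)
  (X-ends : X (fromℕ m) ≡ X Fin.zero mod 2)
  (g : Fin m → ℕ) (g-positive : ∀ t → 0 < g t) (g-injective : Injective _≡_ _≡_ g)
  (g≢K : ∀ t → g t ≢ suc m)
  (X-step : ∀ t → X (Fin.suc t) - X (inject₁ t) ≡± g t)
  where

  K : ℕ
  K = suc m

  reflect : ∀ {n} → ℤ → Fin n → Fin n
  reflect = alternate id opposite

  reflect-involutive : ∀ {n} s (j : Fin n) → reflect s (reflect s j) ≡ j
  reflect-involutive s j with parity s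
  ... | inj₁ _ = refl
  ... | inj₂ _ = FinP.opposite-involutive j

  block : ∀ {n} → ∃ (λ j → n ≡ + toℕ j mod K) → ℤ
  block (j , congruent s _) = X (reflect s j) + s * + K

  Y : ℤ → ℤ
  Y n = block (residue K n)

  block-unique : ∀ {j s} (d : ∃ λ j' → + toℕ j + s * + K ≡ + toℕ j' mod K) →
                 block d ≡ X (reflect s j) + s * + K
  block-unique {j} {s} (j' , congruent s' eq) = helper eq (residue-unique K eq)
    where helper : ∀ {j' s'} eq → j ≡ j' × s ≡ s' → block (j' , congruent s' eq) ≡ X (reflect s j) + s * + K
          helper _ (refl , refl) = refl

  Y-block : ∀ j s → Y (+ toℕ j + s * + K) ≡ X (reflect s j) + s * + K
  Y-block j s = block-unique (residue K (+ toℕ j + s * + K))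

  Y-injective : ∀ {n n'} → Y n ≡ Y n' → n ≡ n'
  Y-injective {n} {n'} eq = from-blocks (residue K n) (residue K n')
    where
    from-blocks : ∃ (λ j → n ≡ + toℕ j mod K) → ∃ (λ j → n' ≡ + toℕ j mod K) → n ≡ n'
    from-blocks (j , congruent s n≡) (j' , congruent s' n'≡) =
      trans n≡ (trans (cong₂ (λ j s → + toℕ j + s * + K) j≡j' s≡s') (sym n'≡))
      where
      eq′ : X (reflect s j) + s * + K ≡ X (reflect s' j') + s' * + K
      eq′ = trans (sym (Y-block j s)) (trans (cong Y (sym n≡)) (trans eq (trans (cong Y n'≡) (Y-block j' s'))))
      r≡r' : reflect s j ≡ reflect s' j'
      r≡r' = X-injective (mod-trans (mod-sym (+-multiple _ s)) (mod-trans (≡⇒≡mod eq′) (+-multiple _ s')))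
      s≡s' : s ≡ s'
      s≡s' = ℤP.*-cancelʳ-≡ s s' (+ K)
        (∙-cancelˡ (X (reflect s j)) _ _ (trans eq′ (cong (λ r → X r + s' * + K) (sym r≡r'))))
      j≡j' : j ≡ j'
      j≡j' = trans (sym (reflect-involutive s j)) (trans (cong (reflect s) r≡r')
               (trans (cong (λ s → reflect s (reflect s' j')) s≡s') (reflect-involutive s' j')))

  Y-surjective : ∀ z → ∃ λ n → Y n ≡ z
  Y-surjective z with X-surjective z
  ... | r , congruent c refl = + toℕ (reflect c r) + c * + K ,
        trans (Y-block (reflect c r) c) (cong (λ r → X r + c * + K) (reflect-involutive c r))

  data Class : Set where
    jump  : Class
    inner : Fin m → Class

  gen : Class → ℕ
  gen jump = K
  gen (inner t) = g t

  lower : Fin m → ℤ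
  lower t = proj₁ (≡±⇒pair (X (inject₁ t)) (X (Fin.suc t)) (X-step t))

  lower-pair : ∀ t → ⟅ X (inject₁ t) , X (Fin.suc t) ⟆≡⟅ lower t , lower t + + g t ⟆
  lower-pair t = proj₂ (≡±⇒pair (X (inject₁ t)) (X (Fin.suc t)) (X-step t))

  low : Class → ℤ → ℤ
  low jump s = X (reflect s (fromℕ m))
  low (inner t) _ = lower t

  base : Class → ℤ → ℤ
  base c s = low c s + s * + K

  low-periodic : ∀ c {s s'} → s ≡ s' mod 2 → low c s ≡ low c s'
  low-periodic jump s≡s' = cong (λ R → X (R (fromℕ m))) (alternate-periodic id opposite s≡s')
  low-periodic (inner t) _ = refl

  last-mod2 : ∀ s → X (reflect s (fromℕ m)) ≡ X (fromℕ m) mod 2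
  last-mod2 s with parity s
  ... | inj₁ _ = ≡⇒≡mod refl
  ... | inj₂ _ = subst (λ r → X r ≡ X (fromℕ m) mod 2) (sym (FinP.opposite-involutive Fin.zero)) (mod-sym X-ends)

  low-parity : ∀ c s s' → low c s ≡ low c s' mod 2
  low-parity jump s s' = mod-trans (last-mod2 s) (mod-sym (last-mod2 s'))
  low-parity (inner t) _ _ = ≡⇒≡mod refl

  YEdge : ℤ → Class → ℤ → Set
  YEdge n c s = ⟅ Y n , Y (n + + 1) ⟆≡⟅ base c s , base c s + + gen c ⟆

  reflect-turn : ∀ s → reflect (s + + 1) Fin.zero ≡ reflect s (fromℕ m)
  reflect-turn s with parity s
  ... | inj₁ s≡0 = cong (λ R → R Fin.zero) (alternate-odd id opposite (mod-+ s≡0 (≡⇒≡mod {x = + 1} refl)))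
  ... | inj₂ s≡1 = trans (cong (λ R → R Fin.zero) (alternate-even id opposite s+1≡0))
                         (sym (FinP.opposite-involutive Fin.zero))
    where s+1≡0 : s + + 1 ≡ + 0 mod 2
          s+1≡0 = mod-trans (mod-+ s≡1 (≡⇒≡mod {x = + 1} refl)) (congruent (+ 1) refl)

  Y-jump : ∀ s → YEdge (+ toℕ (fromℕ m) + s * + K) jump s
  Y-jump s = inj₁ (Y-block (fromℕ m) s , (begin
    Y (+ toℕ (fromℕ m) + s * + K + + 1)               ≡⟨ cong (λ k → Y (+ k + s * + K + + 1)) (FinP.toℕ-fromℕ m) ⟩
    Y (+ m + s * + K + + 1)                           ≡⟨ cong Y (lemma₁ (+ m) s) ⟩
    Y (+ toℕ (Fin.zero {m}) + (s + + 1) * + K)        ≡⟨ Y-block Fin.zero (s + + 1) ⟩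
    X (reflect (s + + 1) Fin.zero) + (s + + 1) * + K  ≡⟨ cong (λ r → X r + (s + + 1) * + K) (reflect-turn s) ⟩
    low jump s + (s + + 1) * + K                      ≡⟨ lemma₂ (low jump s) s (+ K) ⟩
    base jump s + + K                                 ∎))
    where
      open ≡-Reasoning
      lemma₁ : ∀ m s → m + s * (+ 1 + m) + + 1 ≡ + 0 + (s + + 1) * (+ 1 + m)
      lemma₁ = solve-∀
      lemma₂ : ∀ x s k → x + (s + + 1) * k ≡ x + s * k + k
      lemma₂ = solve-∀

  reflect-edge : ∀ s u →
    ⟅ X (reflect s (inject₁ u)) , X (reflect s (Fin.suc u)) ⟆≡⟅ X (inject₁ (reflect s u)) , X (Fin.suc (reflect s u)) ⟆
  reflect-edge s u with parity s
  ... | inj₁ _ = inj₁ (refl , refl)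
  ... | inj₂ _ = inj₂ (cong X (opposite-inject₁ u) , refl)

  Y-inner : ∀ s u → YEdge (+ toℕ (inject₁ u) + s * + K) (inner (reflect s u)) s
  Y-inner s u = subst₂ (λ y y' → ⟅ y , y' ⟆≡⟅ base (inner t) s , base (inner t) s + + g t ⟆)
                  (sym (Y-block (inject₁ u) s)) (sym Y-next)
                  (edge-+ (s * + K) (pair-trans (reflect-edge s u) (lower-pair t)))
    where
      t = reflect s u
      Y-next : Y (+ toℕ (inject₁ u) + s * + K + + 1) ≡ X (reflect s (Fin.suc u)) + s * + K
      Y-next = trans (cong Y (trans (cong (λ k → + k + s * + K + + 1) (FinP.toℕ-inject₁ u))
                                    (lemma (+ toℕ u) s (+ K))))
                     (Y-block (Fin.suc u) s)
        where lemma : ∀ u s k → u + s * k + + 1 ≡ + 1 + u + s * k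
              lemma = solve-∀

  Y-edge : ∀ n → ∃₂ λ c s → YEdge n c s
  Y-edge n = from-block (residue K n)
    where
      from-block : ∃ (λ j → n ≡ + toℕ j mod K) → ∃₂ λ c s → YEdge n c s
      from-block (j , congruent s refl) with view j
      ... | ‵fromℕ = jump , s , Y-jump s
      ... | ‵inject₁ u = inner (reflect s u) , s , Y-inner s u

  Y-covers : ∀ c s → ∃ λ n → YEdge n c s
  Y-covers jump s = _ , Y-jump s
  Y-covers (inner t) s = _ , subst (λ t′ → YEdge (+ toℕ (inject₁ (reflect s t)) + s * + K) (inner t′) s)
                                   (reflect-involutive s t) (Y-inner s (reflect s t))

  gen-positive : ∀ c → 0 < gen c
  gen-positive jump = ℕ.s≤s ℕ.z≤n
  gen-positive (inner t) = g-positive t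

  gen-injective : ∀ {c c'} → gen c ≡ gen c' → c ≡ c'
  gen-injective {jump} {jump} _ = refl
  gen-injective {jump} {inner t} K≡g = ⊥-elim (g≢K t (sym K≡g))
  gen-injective {inner t} {jump} g≡K = ⊥-elim (g≢K t g≡K)
  gen-injective {inner t} {inner t'} g≡g = cong inner (g-injective g≡g)

  Step : ℤ → Set
  Step d = ∃ λ c → d ≡± gen c

  module Tile (c : Class) = Tiling K K-odd (low c) (low-periodic c) (low-parity c)

  path : Fin K → ℤ → ℤ
  path i n = Y n + + toℕ i * + 2

  path-edge : ∀ i n → ∃₂ λ c s →
              ⟅ path i n , path i (n + + 1) ⟆≡⟅ Tile.tile c s i , Tile.tile c s i + + gen c ⟆
  path-edge i n with Y-edge n
  ... | c , s , edge = c , s , edge-+ (+ toℕ i * + 2) edge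

  path-HamPath : ∀ i → HamPath Step (Consecutive (path i))
  path-HamPath i = bijection⇒HamPath Step (λ (c , d≡±) → c , ≡±-neg d≡±) (path i) injective surjective step
    where
      injective : ∀ {n n'} → path i n ≡ path i n' → n ≡ n'
      injective eq = Y-injective (∙-cancelʳ (+ toℕ i * + 2) _ _ eq)
      surjective : ∀ z → ∃ λ n → path i n ≡ z
      surjective z with Y-surjective (z - + toℕ i * + 2)
      ... | n , Yn≡ = n , trans (cong (_+ + toℕ i * + 2) Yn≡) (lemma z (+ toℕ i * + 2))
        where lemma : ∀ z d → z - d + d ≡ z
              lemma = solve-∀
      step : ∀ n → Step (path i (n + + 1) - path i n)
      step n with path-edge i n
      ... | c , _ , edge = c , pair⇒≡± edge

  paths-disjoint : ∀ i i' x y → Consecutive (path i) x y → Consecutive (path i') x y → i ≡ i'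
  paths-disjoint i i' x y (n , xy≡) (n' , xy≡′) with path-edge i n | path-edge i' n'
  ... | c , s , edge | c' , s' , edge' with pair-unique (gen-positive c) (pair-trans xy≡ edge) (pair-trans xy≡′ edge')
  ... | tile≡ , gen≡ = Tile.tile-injective c
          (subst (λ c″ → Tile.tile c s i ≡ Tile.tile c″ s' i') (sym (gen-injective {c} {c'} gen≡)) tile≡)

  paths-cover : ∀ x y → Step (y - x) → ∃ λ i → Consecutive (path i) x y
  paths-cover x y (c , y-x≡±) with ≡±⇒pair x y y-x≡±
  ... | p , xy≡ with Tile.tile-surjective c p
  ... | s , i , p≡ with Y-covers c s
  ... | n , edge = i , n , pair-trans xy≡
          (pair-sym (subst (λ p → ⟅ path i n , path i (n + + 1) ⟆≡⟅ p , p + + gen c ⟆) (sym p≡)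
                           (edge-+ (+ toℕ i * + 2) edge)))

  zigzag-HamDecomposable : HamDecomposable Step
  zigzag-HamDecomposable = Fin K , (λ i → Consecutive (path i)) , path-HamPath , paths-disjoint , paths-cover

-- Lifting a Hamilton path of ℤ_k

↭⇒permutation : ∀ {A : Set} {n} (f g : Fin n → A) → tabulate f ↭ tabulate g →
                Σ (Permutation n n) λ ρ → ∀ i → g (ρ ⟨$⟩ʳ i) ≡ f i
↭⇒permutation {A} {n} f g f↭g = ρ , λ i → begin
  g (ρ ⟨$⟩ʳ i)                                         ≡⟨ ListP.lookup-tabulate g _ ⟨
  lookup (tabulate g) (cast (sym |g|) (ρ ⟨$⟩ʳ i))       ≡⟨ cong (lookup (tabulate g)) (FinP.cast-involutive (sym |g|) |g| _) ⟩
  lookup (tabulate g) (π ⟨$⟩ʳ cast (sym |f|) i)         ≡⟨ PermutationSetoidP.onIndices-lookup (setoid A) (↭⇒↭ₛ f↭g) _ ⟨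
  lookup (tabulate f) (cast (sym |f|) i)                ≡⟨ ListP.lookup-tabulate f i ⟩
  f i                                                   ∎
  where
    open ≡-Reasoning
    |f| : length (tabulate f) ≡ n
    |f| = ListP.length-tabulate f
    |g| : length (tabulate g) ≡ n
    |g| = ListP.length-tabulate g
    π : Permutation (length (tabulate f)) (length (tabulate g))
    π = onIndices (↭⇒↭ₛ f↭g)
    ρ : Permutation n n
    ρ = cast-id (sym |f|) ∘ₚ π ∘ₚ cast-id |g|

lift : ∀ {m} → ℤ → (Fin m → ℤ) → Fin (suc m) → ℤ
lift x e Fin.zero = x
lift {suc m} x e (Fin.suc r) = lift (x + e Fin.zero) (e ∘ Fin.suc) r

lift-step : ∀ {m} x (e : Fin m → ℤ) t → lift x e (Fin.suc t) ≡ lift x e (inject₁ t) + e t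
lift-step x e Fin.zero = refl
lift-step x e (Fin.suc t) = lift-step (x + e Fin.zero) (e ∘ Fin.suc) t

lift-mod : ∀ {m n} (q : Fin (suc m) → ℤ) (e : Fin m → ℤ) →
           (∀ t → e t ≡ q (Fin.suc t) - q (inject₁ t) mod n) → ∀ r → lift (q Fin.zero) e r ≡ q r mod n
lift-mod {n = n} q e e≡ = <-weakInduction (λ r → lift (q Fin.zero) e r ≡ q r mod n) (≡⇒≡mod refl) step
  where
    step : ∀ t → lift (q Fin.zero) e (inject₁ t) ≡ q (inject₁ t) mod n →
                 lift (q Fin.zero) e (Fin.suc t) ≡ q (Fin.suc t) mod n
    step t IH = subst (λ x → x ≡ q (Fin.suc t) mod n) (sym (lift-step (q Fin.zero) e t))
      (mod-trans (mod-+ IH (e≡ t)) (≡⇒≡mod (lemma (q (inject₁ t)) (q (Fin.suc t)))))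
      where lemma : ∀ x y → x + (y - x) ≡ y
            lemma = solve-∀

≡±⇒≡mod2 : ∀ {d a} → d ≡± a → d ≡ + a mod 2
≡±⇒≡mod2 (inj₁ refl) = ≡⇒≡mod refl
≡±⇒≡mod2 {a = a} (inj₂ refl) = congruent (- + a) (lemma (+ a))
  where lemma : ∀ a → - a ≡ a + - a * + 2
        lemma = solve-∀

lift-parity : ∀ {m} x (e : Fin m → ℤ) (g : Fin m → ℕ) → (∀ t → e t ≡± g t) →
              lift x e (fromℕ m) ≡ x + + sum g mod 2
lift-parity {zero} x e g _ = ≡⇒≡mod (sym (ℤP.+-identityʳ x))
lift-parity {suc m} x e g e≡±g =
  mod-trans (lift-parity (x + e Fin.zero) (e ∘ Fin.suc) (g ∘ Fin.suc) (e≡±g ∘ Fin.suc))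
    (subst (λ y → x + e Fin.zero + + sum (g ∘ Fin.suc) ≡ y mod 2) regroup
      (mod-+ (mod-+ (≡⇒≡mod {x = x} refl) (≡±⇒≡mod2 (e≡±g Fin.zero))) (≡⇒≡mod refl)))
  where
    regroup : x + + g Fin.zero + + sum (g ∘ Fin.suc) ≡ x + + sum g
    regroup = trans (ℤP.+-assoc x (+ g Fin.zero) (+ sum (g ∘ Fin.suc)))
                    (cong (_+_ x) (sym (ℤP.pos-+ (g Fin.zero) (sum (g ∘ Fin.suc)))))

injective⇒surjective : ∀ {n} (f : Fin n → Fin n) → Injective _≡_ _≡_ f → ∀ y → ∃ λ x → f x ≡ y
injective⇒surjective {suc n} f f-injective y with FinP.any? (λ x → f x FinP.≟ y)
... | yes found = found
... | no ¬found = ⊥-elim (ℕP.<-irrefl refl (FinP.injective⇒≤ punchOut-injective))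
  where
    y≢f : ∀ x → y ≢ f x
    y≢f x y≡fx = ¬found (x , sym y≡fx)
    punchOut-injective : Injective _≡_ _≡_ (λ x → punchOut (y≢f x))
    punchOut-injective eq = f-injective (FinP.punchOut-injective (y≢f _) (y≢f _) eq)

sum-tabulate : ∀ {n} (f : Fin n → ℕ) → List.sum (tabulate f) ≡ sum f
sum-tabulate {zero} f = refl
sum-tabulate {suc n} f = cong (f Fin.zero ℕ.+_) (sum-tabulate (f ∘ Fin.suc))

module Lifting (m : ℕ) (K-odd : + suc m ≡ + 1 mod 2)
  (a : Fin m → ℕ) (a-injective : Injective _≡_ _≡_ a) (a-positive : ∀ i → 0 < a i)
  (K∤a : ∀ i → ¬ (suc m ∣ a i))
  (sum-even : + sum a ≡ + 0 mod 2)
  (Q : Fin (suc m) → Fin (suc m)) (Q-injective : Injective _≡_ _≡_ Q)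
  (ρ : Permutation m m)
  (ρ-lengths : ∀ t → len (suc m) 0 (a (ρ ⟨$⟩ʳ t)) ≡
                     len (suc m) (toℕ (Q (inject₁ t))) (toℕ (Q (Fin.suc t))))
  where

  K : ℕ
  K = suc m

  q : Fin K → ℤ
  q r = + toℕ (Q r)

  g : Fin m → ℕ
  g t = a (ρ ⟨$⟩ʳ t)

  signed-step : ∀ t → ∃ λ e → (e ≡± g t) × (q (Fin.suc t) - q (inject₁ t) ≡ e mod K)
  signed-step t =
    ≡±mod⇒signed (len-≡⇒≡±mod m (toℕ (Q (inject₁ t))) (toℕ (Q (Fin.suc t))) (g t) (sym (ρ-lengths t)))

  X : Fin K → ℤ
  X = lift (q Fin.zero) (λ t → proj₁ (signed-step t))

  X≡q : ∀ r → X r ≡ q r mod K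
  X≡q = lift-mod q _ (λ t → mod-sym (proj₂ (proj₂ (signed-step t))))

  X-injective : ∀ {r r'} → X r ≡ X r' mod K → r ≡ r'
  X-injective {r} {r'} Xr≡Xr' = Q-injective (FinP.toℕ-injective
    (mod-unique (FinP.toℕ<n (Q r)) (FinP.toℕ<n (Q r')) (mod-trans (mod-sym (X≡q r)) (mod-trans Xr≡Xr' (X≡q r')))))

  X-surjective : ∀ z → ∃ λ r → z ≡ X r mod K
  X-surjective z with residue K z
  ... | j , z≡j with injective⇒surjective Q Q-injective j
  ...   | r , refl = r , mod-trans z≡j (mod-sym (X≡q r))

  X-step : ∀ t → X (Fin.suc t) - X (inject₁ t) ≡± g t
  X-step t = subst (_≡± g t)
    (sym (trans (cong (_- X (inject₁ t)) (lift-step (q Fin.zero) _ t)) (lemma (X (inject₁ t)) _)))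
    (proj₁ (proj₂ (signed-step t)))
    where lemma : ∀ x e → x + e - x ≡ e
          lemma = solve-∀

  X-ends : X (fromℕ m) ≡ X Fin.zero mod 2
  X-ends = mod-trans (lift-parity (q Fin.zero) _ g (λ t → proj₁ (proj₂ (signed-step t))))
    (subst (λ S → q Fin.zero + + S ≡ q Fin.zero mod 2) (sum-permute a ρ)
      (mod-trans (mod-+ (≡⇒≡mod {x = q Fin.zero} refl) sum-even) (≡⇒≡mod (ℤP.+-identityʳ _))))

  g-positive : ∀ t → 0 < g t
  g-positive t = a-positive (ρ ⟨$⟩ʳ t)

  g-injective : Injective _≡_ _≡_ g
  g-injective gt≡gt' = trans (sym (inverseˡ ρ)) (trans (cong (ρ ⟨$⟩ˡ_) (a-injective gt≡gt')) (inverseˡ ρ))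

  g≢K : ∀ t → g t ≢ K
  g≢K t gt≡K = K∤a (ρ ⟨$⟩ʳ t) (subst (K ∣_) (sym gt≡K) ∣-refl)

  open ZigZag m K-odd X X-injective X-surjective X-ends g g-positive g-injective g≢K X-step
    using (Step; jump; inner; zigzag-HamDecomposable)

  Step⇒PM : ∀ d → Step d → PM (K ∷ map a (allFin m)) d
  Step⇒PM _ (jump , d≡±K) = here d≡±K
  Step⇒PM d (inner t , d≡±g) =
    there (AnyP.map⁺ {f = a} (AnyP.tabulate⁺ {P = λ i → d ≡± a i} (ρ ⟨$⟩ʳ t) d≡±g))

  PM⇒Step : ∀ d → PM (K ∷ map a (allFin m)) d → Step d
  PM⇒Step _ (here d≡±K) = jump , d≡±K
  PM⇒Step d (there d∈±a) = from-index (AnyP.tabulate⁻ {P = λ i → d ≡± a i} (AnyP.map⁻ {f = a} d∈±a))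
    where
      from-index : ∃ (λ i → d ≡± a i) → Step d
      from-index (i , d≡±a) = inner (ρ ⟨$⟩ˡ i) , subst (d ≡±_) (cong a (sym (inverseʳ ρ))) d≡±a

  hamDecomposable : HamDecomposable (PM (K ∷ map a (allFin m)))
  hamDecomposable = HamDecomposable-resp Step⇒PM PM⇒Step zigzag-HamDecomposable

admissible⇒sum-even : ∀ {m} (a : Fin m → ℕ) → Admissible (suc m ∷ map a (allFin m)) → + sum a ≡ + 0 mod 2
admissible⇒sum-even {m} a (_ , parity≡) =
  mod-cancelʳ (+ suc m) (subst (λ n → + n ≡ + suc m mod 2) (ℕP.+-comm (suc m) (sum a)) K+S≡K)
  where
    S≡ : List.sum (map a (allFin m)) ≡ sum a
    S≡ = trans (cong List.sum (ListP.map-tabulate (λ i → i) a)) (sum-tabulate a)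
    length≡ : length (map a (allFin m)) ≡ m
    length≡ = trans (ListP.length-map a (allFin m)) (ListP.length-tabulate (λ i → i))
    K+S≡K : + (suc m ℕ.+ sum a) ≡ + suc m mod 2
    K+S≡K = mod-trans (mod-sym (%-mod 2 (suc m ℕ.+ sum a)))
      (mod-trans (≡⇒≡mod (cong +_ (subst₂ (λ S l → (suc m ℕ.+ S) % 2 ≡ suc l % 2) S≡ length≡ parity≡)))
        (%-mod 2 (suc m)))

lemma10 : (k : ℕ) → 3 ≤ k → k % 2 ≡ 1 →
          (a : Fin (k ∸ 1) → ℕ) →
          Injective _≡_ _≡_ a →
          (∀ i → 0 < a i) →
          (∀ i → ¬ (k ∣ a i)) →
          Admissible (k ∷ map a (allFin (k ∸ 1))) →
          (Q : Fin k → Fin k) → Injective _≡_ _≡_ Q →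
          pathLengths k Q ↭ map (λ i → len k 0 (a i)) (allFin (k ∸ 1)) →
          HamDecomposable (PM (k ∷ map a (allFin (k ∸ 1))))
lemma10 (suc m) _ k-odd a a-injective a-positive k∤a admissible Q Q-injective lengths =
  Lifting.hamDecomposable m K-odd a a-injective a-positive k∤a (admissible⇒sum-even a admissible)
    Q Q-injective (proj₁ lengths-permutation) (proj₂ lengths-permutation)
  where
    K-odd : + suc m ≡ + 1 mod 2
    K-odd = mod-trans (mod-sym (%-mod 2 (suc m))) (≡⇒≡mod (cong +_ k-odd))
    lengths-permutation : Σ (Permutation m m) λ ρ →
      ∀ t → len (suc m) 0 (a (ρ ⟨$⟩ʳ t)) ≡ len (suc m) (toℕ (Q (inject₁ t))) (toℕ (Q (Fin.suc t)))
    lengths-permutation = ↭⇒permutation _ _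
      (subst₂ _↭_ (ListP.map-tabulate (λ i → i) _) (ListP.map-tabulate (λ i → i) _) lengths)
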